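{- Let $\mathcal{M}\models T_t$, let $\mathcal{A}$ be an $\mathcal{L}_t$-substructure of $\mathcal{M}$, let $b\in M\setminus A$, and let $p_1(t),\dots,p_n(t)\in\mathbb{Q}(t)$ be $\mathbb{Q}$-linearly independent. Then $\lambda_{p_1(t)}(b),\dots,\lambda_{p_n(t)}(b)$ are $\mathbb{Q}$-linearly independent over $A$.
   Context: $\mathcal{L}=\{<,+,0,1\}$ and $T$ is the complete theory of $(\mathbb{R},<,+,0,1)$. $\mathbb{Q}(t)$ is the field of rational functions over $\mathbb{Q}$ in one variable $t$. $\mathcal{L}_t=\mathcal{L}\cup\{\lambda_{q(t)}: q(t)\in\mathbb{Q}(t)\}$ with unary function symbols $\lambda_{q(t)}$. $T_t$ is the $\mathcal{L}_t$-theory consisting of $T$ together with: (T1) $(M,+,0,(\lambda_{q(t)})_{q(t)})$ is a $\mathbb{Q}(t)$-vector space; (T2) whenever $q_1(t),\dots,q_m(t)\in\mathbb{Q}(t)$ are $\mathbb{Q}$-linearly independent, the image of $a\mapsto(\lambda_{q_1(t)}(a),\dots,\lambda_{q_m(t)}(a))$ is dense in $M^m$. Elements $c_1,\dots,c_n$ are $\mathbb{Q}$-linearly independent over $A$ if no nontrivial $\mathbb{Q}$-linear combination of them lies in the $\mathbb{Q}$-span of $A$. -}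

module Defs where

open import Level using (0ℓ)
open import Data.Nat using (ℕ; zero; suc)
open import Data.Fin using (Fin; zero; suc)
open import Data.Rational as ℚ using (ℚ; 0ℚ; 1ℚ)
open import Data.List using (List; []; _∷_; map)
open import Data.List.Relation.Unary.All using (All)
open import Data.Product using (Σ; _×_; _,_; proj₁; proj₂; ∃)
open import Relation.Nullary using (¬_)
open import Data.Sum using (_⊎_)
open import Relation.Binary.PropositionalEquality using (_≡_)

-- Polynomials over ℚ: coefficient lists, lowest degree first.

Poly : Set
Poly = List ℚ

infixl 6 _+P_
infixl 7 _*P_

_+P_ : Poly → Poly → Poly
[] +P q = q
(a ∷ p) +P [] = a ∷ p
(a ∷ p) +P (b ∷ q) = (a ℚ.+ b) ∷ (p +P q)

scaleP : ℚ → Poly → Poly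
scaleP r p = map (r ℚ.*_) p

negP : Poly → Poly
negP p = map ℚ.-_ p

_*P_ : Poly → Poly → Poly
[] *P q = []
(a ∷ p) *P q = scaleP a q +P (0ℚ ∷ (p *P q))

IsZeroP : Poly → Set
IsZeroP p = All (_≡ 0ℚ) p

-- equality of polynomials (up to trailing zero coefficients)
_≈P_ : Poly → Poly → Set
p ≈P q = IsZeroP (p +P negP q)

Frac : Set
Frac = Poly × Poly

_≈F_ : Frac → Frac → Set
(a , b) ≈F (c , d) = (a *P d) ≈P (c *P b)

_+F_ : Frac → Frac → Frac
(a , b) +F (c , d) = ((a *P d) +P (c *P b)) , (b *P d)

_*F_ : Frac → Frac → Frac
(a , b) *F (c , d) = (a *P c) , (b *P d)

scaleF : ℚ → Frac → Frac
scaleF r (a , b) = scaleP r a , b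

zeroF : Frac
zeroF = [] , (1ℚ ∷ [])

-- an element of ℚ(t): a fraction with nonzero denominator
-- (two such are the same element of ℚ(t) iff they are ≈F)
record RatFun : Set where
  constructor mkRF
  field
    num : Poly
    den : Poly
    den≠0 : ¬ IsZeroP den

toFrac : RatFun → Frac
toFrac f = RatFun.num f , RatFun.den f

constRF : ℚ → RatFun
constRF r = mkRF (r ∷ []) (1ℚ ∷ []) λ { (() All.∷ _) }
  where open import Data.List.Relation.Unary.All as All using ()

linCombF : (n : ℕ) → (Fin n → ℚ) → (Fin n → RatFun) → Frac
linCombF zero c f = zeroF
linCombF (suc n) c f =
  scaleF (c zero) (toFrac (f zero)) +F linCombF n (λ i → c (suc i)) (λ i → f (suc i))

QLinIndepRF : (n : ℕ) → (Fin n → RatFun) → Set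
QLinIndepRF n q =
  (c : Fin n → ℚ) → linCombF n c q ≈F zeroF → (i : Fin n) → c i ≡ 0ℚ

nTimes : {X : Set} → (X → X → X) → X → ℕ → X → X
nTimes op e zero y = e
nTimes op e (suc k) y = op y (nTimes op e k y)

-- Models of T_t.
-- T = Th(ℝ,<,+,0,1) is axiomatised by: nontrivial divisible ordered
-- abelian group with 0 < 1 (this theory is complete).

record ModelTt : Set₁ where
  infixl 6 _⊕_
  infix 4 _≺_
  field
    M   : Set
    _≺_ : M → M → Set
    _⊕_ : M → M → M
    𝟘   : M
    𝟙   : M
    λ[_] : RatFun → M → M
    ⊕-assoc : ∀ x y z → (x ⊕ y) ⊕ z ≡ x ⊕ (y ⊕ z)
    ⊕-comm  : ∀ x y → x ⊕ y ≡ y ⊕ x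
    ⊕-idʳ   : ∀ x → x ⊕ 𝟘 ≡ x
    ⊕-inv   : ∀ x → ∃ λ y → x ⊕ y ≡ 𝟘
    ≺-irrefl : ∀ x → ¬ (x ≺ x)
    ≺-trans  : ∀ x y z → x ≺ y → y ≺ z → x ≺ z
    ≺-trich  : ∀ x y → (x ≺ y) ⊎ ((x ≡ y) ⊎ (y ≺ x))
    ≺-⊕      : ∀ x y z → x ≺ y → x ⊕ z ≺ y ⊕ z
    divisible : ∀ (n : ℕ) x → ∃ λ y → nTimes _⊕_ 𝟘 (suc n) y ≡ x
    𝟘≺𝟙 : 𝟘 ≺ 𝟙
    -- (T1) ℚ(t)-vector space (stated relationally on representatives)
    λ-⊕    : ∀ f x y → λ[ f ] (x ⊕ y) ≡ λ[ f ] x ⊕ λ[ f ] y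
    λ-sum  : ∀ f g h → toFrac h ≈F (toFrac f +F toFrac g) →
             ∀ x → λ[ h ] x ≡ λ[ f ] x ⊕ λ[ g ] x
    λ-prod : ∀ f g h → toFrac h ≈F (toFrac f *F toFrac g) →
             ∀ x → λ[ h ] x ≡ λ[ f ] (λ[ g ] x)
    λ-one  : ∀ h → toFrac h ≈F toFrac (constRF 1ℚ) → ∀ x → λ[ h ] x ≡ x
    dense : ∀ (m : ℕ) (q : Fin m → RatFun) → QLinIndepRF m q →
            ∀ (lo hi : Fin m → M) → (∀ i → lo i ≺ hi i) →
            ∃ λ a → ∀ i → (lo i ≺ λ[ q i ] a) × (λ[ q i ] a ≺ hi i)

module _ (𝓜 : ModelTt) where
  open ModelTt 𝓜

  _·ℚ_ : ℚ → M → M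
  r ·ℚ x = λ[ constRF r ] x

  ΣM : (n : ℕ) → (Fin n → M) → M
  ΣM zero v = 𝟘
  ΣM (suc n) v = v zero ⊕ ΣM n (λ i → v (suc i))

  record IsSubstructure (A : M → Set) : Set where
    field
      A-𝟘 : A 𝟘
      A-𝟙 : A 𝟙
      A-⊕ : ∀ x y → A x → A y → A (x ⊕ y)
      A-λ : ∀ f x → A x → A (λ[ f ] x)

  InQSpan : (A : M → Set) → M → Set
  InQSpan A x = Σ ℕ λ k → Σ (Fin k → ℚ) λ s → Σ (Fin k → M) λ a →
                  ((j : Fin k) → A (a j)) × (x ≡ ΣM k (λ j → s j ·ℚ a j))

  QLinIndepOver : (A : M → Set) → (n : ℕ) → (Fin n → M) → Set
  QLinIndepOver A n c =
    (r : Fin n → ℚ) → InQSpan A (ΣM n (λ i → r i ·ℚ c i)) → (i : Fin n) → r i ≡ 0ℚ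

-- Since the λ's are ℚ-linear, Σ rᵢ λ_{pᵢ}(b) = λ_q(b) with q = Σ rᵢ pᵢ. If this lies in the
-- ℚ-span of A it lies in A. When q = 0, the independence of the pᵢ forces every rᵢ = 0;
-- otherwise q is invertible in ℚ(t), and b = λ_{1/q}(λ_q(b)) ∈ A, contradicting b ∉ A.
module Submission where

open import Defs
open import Data.Nat using (ℕ; zero; suc)
open import Data.Rational using (ℚ; 0ℚ; 1ℚ; _+_; _*_; -_; 1/_; ≢-nonZero)
open import Data.Rational.Properties
open import Data.List using ([]; _∷_)
open import Data.List.Relation.Unary.All using ([]; _∷_; all?)
open import Data.Fin using (Fin)
open import Data.Product using (_,_; proj₁; proj₂)
open import Data.Empty using (⊥-elim)
open import Function using (_∘_)
open import Relation.Nullary using (¬_; yes; no)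
open import Relation.Binary.Bundles using (Setoid)
import Relation.Binary.Reasoning.Setoid
open import Relation.Binary.PropositionalEquality
open import Algebra.Bundles using (CommutativeMonoid)
open import Algebra.Properties.CommutativeSemigroup
  (CommutativeMonoid.commutativeSemigroup +-0-commutativeMonoid) using (x∙yz≈y∙xz)

*-≢0 : ∀ {a b} → a ≢ 0ℚ → b ≢ 0ℚ → a * b ≢ 0ℚ
*-≢0 {a} {b} a≢0 b≢0 ab≡0 = b≢0 (begin
  b               ≡⟨ sym (*-identityˡ b) ⟩
  1ℚ * b          ≡⟨ cong (_* b) (sym (*-inverseˡ a {{≢-nonZero a≢0}})) ⟩
  (a⁻¹ * a) * b   ≡⟨ *-assoc a⁻¹ a b ⟩
  a⁻¹ * (a * b)   ≡⟨ cong (a⁻¹ *_) ab≡0 ⟩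
  a⁻¹ * 0ℚ        ≡⟨ *-zeroʳ a⁻¹ ⟩
  0ℚ              ∎)
  where
  open ≡-Reasoning
  a⁻¹ = 1/_ a {{≢-nonZero a≢0}}

coeff : Poly → ℕ → ℚ
coeff []      _       = 0ℚ
coeff (a ∷ p) zero    = a
coeff (a ∷ p) (suc k) = coeff p k

coeff-+P : ∀ p q k → coeff (p +P q) k ≡ coeff p k + coeff q k
coeff-+P []      q       k       = sym (+-identityˡ _)
coeff-+P (a ∷ p) []      k       = sym (+-identityʳ _)
coeff-+P (a ∷ p) (b ∷ q) zero    = refl
coeff-+P (a ∷ p) (b ∷ q) (suc k) = coeff-+P p q k

coeff-scaleP : ∀ r p k → coeff (scaleP r p) k ≡ r * coeff p k
coeff-scaleP r []      k       = sym (*-zeroʳ r)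
coeff-scaleP r (a ∷ p) zero    = refl
coeff-scaleP r (a ∷ p) (suc k) = coeff-scaleP r p k

coeff-negP : ∀ p k → coeff (negP p) k ≡ - coeff p k
coeff-negP []      k       = refl
coeff-negP (a ∷ p) zero    = refl
coeff-negP (a ∷ p) (suc k) = coeff-negP p k

-- Equality in ℚ[t]; a record so that both sides can be inferred.
infix 4 _≋_
record _≋_ (p q : Poly) : Set where
  constructor mk≋
  field coeff-≡ : ∀ k → coeff p k ≡ coeff q k
open _≋_

≋-refl : ∀ {p} → p ≋ p
≋-refl = mk≋ λ _ → refl

≋-sym : ∀ {p q} → p ≋ q → q ≋ p
≋-sym p≋q = mk≋ (sym ∘ coeff-≡ p≋q)

≋-trans : ∀ {p q r} → p ≋ q → q ≋ r → p ≋ r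
≋-trans p≋q q≋r = mk≋ λ k → trans (coeff-≡ p≋q k) (coeff-≡ q≋r k)

≋-setoid : Setoid _ _
≋-setoid = record
  { Carrier = Poly
  ; _≈_ = _≋_
  ; isEquivalence = record { refl = ≋-refl ; sym = ≋-sym ; trans = ≋-trans }
  }

module ≋-Reasoning = Relation.Binary.Reasoning.Setoid ≋-setoid

IsZeroP⇒≋[] : ∀ {p} → IsZeroP p → p ≋ []
IsZeroP⇒≋[] []         = ≋-refl
IsZeroP⇒≋[] (a≡0 ∷ p0) = mk≋ λ { zero → a≡0 ; (suc k) → coeff-≡ (IsZeroP⇒≋[] p0) k }

≋[]⇒IsZeroP : ∀ {p} → p ≋ [] → IsZeroP p
≋[]⇒IsZeroP {[]}    _    = []
≋[]⇒IsZeroP {a ∷ p} p≋[] = coeff-≡ p≋[] zero ∷ ≋[]⇒IsZeroP (mk≋ (coeff-≡ p≋[] ∘ suc))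

≋⇒≈P : ∀ {p q} → p ≋ q → p ≈P q
≋⇒≈P {p} {q} p≋q = ≋[]⇒IsZeroP (mk≋ λ k → begin
  coeff (p +P negP q) k        ≡⟨ coeff-+P p (negP q) k ⟩
  coeff p k + coeff (negP q) k ≡⟨ cong₂ _+_ (coeff-≡ p≋q k) (coeff-negP q k) ⟩
  coeff q k + - coeff q k      ≡⟨ +-inverseʳ (coeff q k) ⟩
  0ℚ                           ∎)
  where open ≡-Reasoning

∷-cong : ∀ {a b p q} → a ≡ b → p ≋ q → a ∷ p ≋ b ∷ q
∷-cong a≡b p≋q = mk≋ λ { zero → a≡b ; (suc k) → coeff-≡ p≋q k }

0∷-≋[] : ∀ {p} → p ≋ [] → 0ℚ ∷ p ≋ []
0∷-≋[] p≋[] = mk≋ λ { zero → refl ; (suc k) → coeff-≡ p≋[] k }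

∷-≋[]⁻¹ : ∀ {a p} → a ∷ p ≋ [] → p ≋ []
∷-≋[]⁻¹ ap≋[] = mk≋ (coeff-≡ ap≋[] ∘ suc)

+P-cong : ∀ {p p′ q q′} → p ≋ p′ → q ≋ q′ → p +P q ≋ p′ +P q′
+P-cong {p} {p′} {q} {q′} p≋p′ q≋q′ = mk≋ λ k → begin
  coeff (p +P q) k       ≡⟨ coeff-+P p q k ⟩
  coeff p k + coeff q k   ≡⟨ cong₂ _+_ (coeff-≡ p≋p′ k) (coeff-≡ q≋q′ k) ⟩
  coeff p′ k + coeff q′ k ≡⟨ coeff-+P p′ q′ k ⟨
  coeff (p′ +P q′) k     ∎
  where open ≡-Reasoning

+P-swap : ∀ p q r → p +P (q +P r) ≋ q +P (p +P r)
+P-swap p q r = mk≋ λ k → begin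
  coeff (p +P (q +P r)) k                   ≡⟨ coeff-+P p (q +P r) k ⟩
  coeff p k + coeff (q +P r) k              ≡⟨ cong (coeff p k +_) (coeff-+P q r k) ⟩
  coeff p k + (coeff q k + coeff r k)       ≡⟨ x∙yz≈y∙xz (coeff p k) (coeff q k) (coeff r k) ⟩
  coeff q k + (coeff p k + coeff r k)       ≡⟨ cong (coeff q k +_) (coeff-+P p r k) ⟨
  coeff q k + coeff (p +P r) k              ≡⟨ coeff-+P q (p +P r) k ⟨
  coeff (q +P (p +P r)) k                   ∎
  where open ≡-Reasoning

+P-[0] : ∀ p → p +P (0ℚ ∷ []) ≋ p
+P-[0] p = mk≋ λ k → trans (coeff-+P p (0ℚ ∷ []) k) (trans (cong (coeff p k +_) (coeff-[0] k)) (+-identityʳ _))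
  where
  coeff-[0] : ∀ k → coeff (0ℚ ∷ []) k ≡ 0ℚ
  coeff-[0] zero    = refl
  coeff-[0] (suc k) = refl

scaleP-cong : ∀ r {p q} → p ≋ q → scaleP r p ≋ scaleP r q
scaleP-cong r {p} {q} p≋q = mk≋ λ k →
  trans (coeff-scaleP r p k) (trans (cong (r *_) (coeff-≡ p≋q k)) (sym (coeff-scaleP r q k)))

scaleP-zeroˡ : ∀ {a} q → a ≡ 0ℚ → scaleP a q ≋ []
scaleP-zeroˡ {a} q a≡0 = mk≋ λ k →
  trans (coeff-scaleP a q k) (trans (cong (_* coeff q k) a≡0) (*-zeroˡ (coeff q k)))

scaleP-identityˡ : ∀ p → scaleP 1ℚ p ≋ p
scaleP-identityˡ p = mk≋ λ k → trans (coeff-scaleP 1ℚ p k) (*-identityˡ _)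

*P-zeroʳ : ∀ p → p *P [] ≋ []
*P-zeroʳ []      = ≋-refl
*P-zeroʳ (a ∷ p) = 0∷-≋[] (*P-zeroʳ p)

*P-congʳ : ∀ p {q q′} → q ≋ q′ → p *P q ≋ p *P q′
*P-congʳ []      q≋q′ = ≋-refl
*P-congʳ (a ∷ p) q≋q′ = +P-cong (scaleP-cong a q≋q′) (∷-cong refl (*P-congʳ p q≋q′))

*P-∷ʳ : ∀ q a p → q *P (a ∷ p) ≋ scaleP a q +P (0ℚ ∷ (q *P p))
*P-∷ʳ []      a p = mk≋ λ { zero → refl ; (suc k) → refl }
*P-∷ʳ (b ∷ q) a p = ∷-cong (cong (_+ 0ℚ) (*-comm b a))
  (≋-trans (+P-cong (≋-refl {scaleP b p}) (*P-∷ʳ q a p))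
           (+P-swap (scaleP b p) (scaleP a q) (0ℚ ∷ (q *P p))))

*P-comm : ∀ p q → p *P q ≋ q *P p
*P-comm []      q = ≋-sym (*P-zeroʳ q)
*P-comm (a ∷ p) q =
  ≋-trans (+P-cong (≋-refl {scaleP a q}) (∷-cong refl (*P-comm p q))) (≋-sym (*P-∷ʳ q a p))

*P-congˡ : ∀ {p p′} q → p ≋ p′ → p *P q ≋ p′ *P q
*P-congˡ {p} {p′} q p≋p′ = ≋-trans (*P-comm p q) (≋-trans (*P-congʳ q p≋p′) (*P-comm q p′))

constP-*P : ∀ r p → (r ∷ []) *P p ≋ scaleP r p
constP-*P r p = +P-[0] (scaleP r p)

*P-identityˡ : ∀ p → (1ℚ ∷ []) *P p ≋ p
*P-identityˡ p = ≋-trans (constP-*P 1ℚ p) (scaleP-identityˡ p)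

0∷-*P : ∀ p q → (0ℚ ∷ p) *P q ≋ 0ℚ ∷ (p *P q)
0∷-*P p q = +P-cong (scaleP-zeroˡ q refl) ≋-refl

*P-0∷ : ∀ p q → p *P (0ℚ ∷ q) ≋ 0ℚ ∷ (p *P q)
*P-0∷ p q = ≋-trans (*P-∷ʳ p 0ℚ q) (+P-cong (scaleP-zeroˡ p refl) ≋-refl)

-- Leading zero coefficients are stripped until both constant terms are nonzero.
*P-≢[] : ∀ p q → ¬ p ≋ [] → ¬ q ≋ [] → ¬ p *P q ≋ []
*P-≢[] []      q p≢[] q≢[] _ = p≢[] ≋-refl
*P-≢[] (a ∷ p) q p≢[] q≢[] apq≋[] with a ≟ 0ℚ
... | yes refl = *P-≢[] p q (p≢[] ∘ 0∷-≋[]) q≢[]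
                   (∷-≋[]⁻¹ (≋-trans (≋-sym (0∷-*P p q)) apq≋[]))
... | no a≢0   = constant-≢0 q q≢[] apq≋[]
  where
  constant-≢0 : ∀ q → ¬ q ≋ [] → ¬ (a ∷ p) *P q ≋ []
  constant-≢0 []      q≢[] _ = q≢[] ≋-refl
  constant-≢0 (b ∷ q) q≢[] apbq≋[] with b ≟ 0ℚ
  ... | yes refl = constant-≢0 q (q≢[] ∘ 0∷-≋[])
                     (∷-≋[]⁻¹ (≋-trans (≋-sym (*P-0∷ (a ∷ p) q)) apbq≋[]))
  ... | no b≢0   = *-≢0 a≢0 b≢0 (trans (sym (+-identityʳ (a * b))) (coeff-≡ apbq≋[] zero))

≈F-refl : ∀ x → x ≈F x
≈F-refl (a , b) = ≋⇒≈P {a *P b} ≋-refl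

numerator-zero⇒≈F-zeroF : ∀ x → IsZeroP (proj₁ x) → x ≈F zeroF
numerator-zero⇒≈F-zeroF (a , b) a0 = ≋⇒≈P (*P-congˡ (1ℚ ∷ []) (IsZeroP⇒≋[] a0))

linCombF-den≢0 : ∀ n c f → ¬ IsZeroP (proj₂ (linCombF n c f))
linCombF-den≢0 zero    c f (() ∷ _)
linCombF-den≢0 (suc n) c f den0 =
  *P-≢[] (RatFun.den (f Fin.zero)) (proj₂ (linCombF n (c ∘ Fin.suc) (f ∘ Fin.suc)))
    (RatFun.den≠0 (f Fin.zero) ∘ ≋[]⇒IsZeroP)
    (linCombF-den≢0 n (c ∘ Fin.suc) (f ∘ Fin.suc) ∘ ≋[]⇒IsZeroP)
    (IsZeroP⇒≋[] den0)

linCombRF : (n : ℕ) → (Fin n → ℚ) → (Fin n → RatFun) → RatFun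
linCombRF n c f = mkRF (proj₁ (linCombF n c f)) (proj₂ (linCombF n c f)) (linCombF-den≢0 n c f)

scaleRF : ℚ → RatFun → RatFun
scaleRF r f = mkRF (scaleP r (RatFun.num f)) (RatFun.den f) (RatFun.den≠0 f)

invRF : (f : RatFun) → ¬ IsZeroP (RatFun.num f) → RatFun
invRF f num≢0 = mkRF (RatFun.den f) (RatFun.num f) num≢0

scaleRF-≈F : ∀ r f → toFrac (scaleRF r f) ≈F (toFrac (constRF r) *F toFrac f)
scaleRF-≈F r (mkRF N D _) = ≋⇒≈P (begin
  scaleP r N *P ((1ℚ ∷ []) *P D) ≈⟨ *P-congʳ (scaleP r N) (*P-identityˡ D) ⟩
  scaleP r N *P D                ≈⟨ *P-congˡ D (constP-*P r N) ⟨
  ((r ∷ []) *P N) *P D           ∎)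
  where open ≋-Reasoning

invRF-*F : ∀ f num≢0 → toFrac (constRF 1ℚ) ≈F (toFrac (invRF f num≢0) *F toFrac f)
invRF-*F (mkRF N D _) _ = ≋⇒≈P (begin
  (1ℚ ∷ []) *P (N *P D) ≈⟨ *P-identityˡ (N *P D) ⟩
  N *P D                ≈⟨ *P-comm N D ⟩
  D *P N                ≈⟨ *P-identityˡ (D *P N) ⟨
  (1ℚ ∷ []) *P (D *P N) ≈⟨ *P-comm (1ℚ ∷ []) (D *P N) ⟩
  (D *P N) *P (1ℚ ∷ []) ∎)
  where open ≋-Reasoning

module _ (𝓜 : ModelTt) where
  open ModelTt 𝓜

  x⊕x≡x⇒x≡𝟘 : ∀ x → x ⊕ x ≡ x → x ≡ 𝟘
  x⊕x≡x⇒x≡𝟘 x x⊕x≡x with ⊕-inv x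
  ... | y , x⊕y≡𝟘 = begin
    x             ≡⟨ ⊕-idʳ x ⟨
    x ⊕ 𝟘         ≡⟨ cong (x ⊕_) x⊕y≡𝟘 ⟨
    x ⊕ (x ⊕ y)   ≡⟨ ⊕-assoc x x y ⟨
    (x ⊕ x) ⊕ y   ≡⟨ cong (_⊕ y) x⊕x≡x ⟩
    x ⊕ y         ≡⟨ x⊕y≡𝟘 ⟩
    𝟘             ∎
    where open ≡-Reasoning

  λ-scaleRF : ∀ r f x → λ[ scaleRF r f ] x ≡ _·ℚ_ 𝓜 r (λ[ f ] x)
  λ-scaleRF r f = λ-prod (constRF r) f (scaleRF r f) (scaleRF-≈F r f)

  λ-linCombRF : ∀ n c f x →
                λ[ linCombRF n c f ] x ≡ ΣM 𝓜 n (λ i → _·ℚ_ 𝓜 (c i) (λ[ f i ] x))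
  λ-linCombRF zero    c f x =
    x⊕x≡x⇒x≡𝟘 _ (sym (λ-sum (linCombRF 0 c f) (linCombRF 0 c f) (linCombRF 0 c f) (≋⇒≈P {[]} ≋-refl) x))
  λ-linCombRF (suc n) c f x = begin
    λ[ linCombRF (suc n) c f ] x
      ≡⟨ λ-sum (scaleRF (c Fin.zero) (f Fin.zero)) (linCombRF n (c ∘ Fin.suc) (f ∘ Fin.suc))
               (linCombRF (suc n) c f) (≈F-refl (toFrac (linCombRF (suc n) c f))) x ⟩
    λ[ scaleRF (c Fin.zero) (f Fin.zero) ] x ⊕ λ[ linCombRF n (c ∘ Fin.suc) (f ∘ Fin.suc) ] x
      ≡⟨ cong₂ _⊕_ (λ-scaleRF (c Fin.zero) (f Fin.zero) x) (λ-linCombRF n (c ∘ Fin.suc) (f ∘ Fin.suc) x) ⟩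
    ΣM 𝓜 (suc n) (λ i → _·ℚ_ 𝓜 (c i) (λ[ f i ] x))
      ∎
    where open ≡-Reasoning

  λ-invRF : ∀ f num≢0 x → λ[ invRF f num≢0 ] (λ[ f ] x) ≡ x
  λ-invRF f num≢0 x = begin
    λ[ invRF f num≢0 ] (λ[ f ] x) ≡⟨ λ-prod (invRF f num≢0) f (constRF 1ℚ) (invRF-*F f num≢0) x ⟨
    λ[ constRF 1ℚ ] x             ≡⟨ λ-one (constRF 1ℚ) (≈F-refl (toFrac (constRF 1ℚ))) x ⟩
    x                             ∎
    where open ≡-Reasoning

  module _ {A : M → Set} (A-sub : IsSubstructure 𝓜 A) where
    open IsSubstructure A-sub

    ΣM-closed : ∀ k (v : Fin k → M) → (∀ j → A (v j)) → A (ΣM 𝓜 k v)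
    ΣM-closed zero    v v∈A = A-𝟘
    ΣM-closed (suc k) v v∈A = A-⊕ _ _ (v∈A Fin.zero) (ΣM-closed k (v ∘ Fin.suc) (v∈A ∘ Fin.suc))

    InQSpan⇒∈ : ∀ {x} → InQSpan 𝓜 A x → A x
    InQSpan⇒∈ (k , s , a , a∈A , refl) = ΣM-closed k _ (λ j → A-λ (constRF (s j)) (a j) (a∈A j))

    λ∈⇒∈ : ∀ f num≢0 {x} → A (λ[ f ] x) → A x
    λ∈⇒∈ f num≢0 {x} fx∈A = subst A (λ-invRF f num≢0 x) (A-λ (invRF f num≢0) _ fx∈A)

lemma3p6 : (𝓜 : ModelTt) (A : ModelTt.M 𝓜 → Set) → IsSubstructure 𝓜 A →
           (b : ModelTt.M 𝓜) → ¬ A b →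
           (n : ℕ) (p : Fin n → RatFun) → QLinIndepRF n p →
           QLinIndepOver 𝓜 A n (λ i → ModelTt.λ[_] 𝓜 (p i) b)
lemma3p6 𝓜 A A-sub b b∉A n p p-indep r span i with all? (_≟ 0ℚ) (proj₁ (linCombF n r p))
... | yes num≡0 = p-indep r (numerator-zero⇒≈F-zeroF (linCombF n r p) num≡0) i
... | no num≢0  = ⊥-elim (b∉A (λ∈⇒∈ 𝓜 A-sub (linCombRF n r p) num≢0 qb∈A))
  where
  qb∈A : A (ModelTt.λ[_] 𝓜 (linCombRF n r p) b)
  qb∈A = subst A (sym (λ-linCombRF 𝓜 n r p b)) (InQSpan⇒∈ 𝓜 A-sub span)
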